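{- Let $X$, $Y$ and $Z$ be edge-disjoint graphs with orderings $\ell_X$, $\ell_Y$ and $\ell_Z$, respectively. Then \[ \mathrm{ms}(\ell_X \vee \ell_Y \vee \ell_Z) \geq \min\left\{ \mathrm{ms}(\ell_X \vee \ell_Y),\ \mathrm{ms}(\ell_Y \vee \ell_Z),\ |E(Y)|+ \mathrm{ms}(\ell_X \vee \ell_Z) \right\}. \]
   Context: All graphs are simple; two edges are adjacent if they share a vertex. An ordering of a graph $G$ with $m$ edges is a bijection $\ell:E(G)\to\mathbb{Z}_m$; for distinct edges $e,e'$, $d_\ell(e,e')$ is the smallest positive integer $d$ with $\ell(e)+d=\ell(e')$ in $\mathbb{Z}_m$. $\mathrm{ms}(\ell)$ is the largest $s\in\{1,\dots,m\}$ such that $d_\ell(e,e')\geq s$ for every ordered pair $(e,e')$ of adjacent edges with $\ell(e)<\ell(e')$ (labels compared as integers in $\{0,\dots,m-1\}$). For edge-disjoint graphs $G_0,G_1$ with orderings $\ell_0,\ell_1$, $\ell_0\vee\ell_1$ is the ordering $\ell$ of $G_0\cup G_1$ with $\ell(e)=\ell_0(e)$ for $e\in E(G_0)$ and $\ell(e)=|E(G_0)|+\ell_1(e)$ for $e\in E(G_1)$; this operation is associative. -}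

module Defs where

open import Level using (Level)
open import Data.Nat using (ℕ; _≤_; _<_; _∸_; _+_)
open import Data.Fin using (Fin; toℕ)
open import Data.List using (List; length; lookup; _++_)
open import Data.Product using (_×_; Σ)
open import Data.Sum using (_⊎_)
open import Relation.Binary.PropositionalEquality using (_≡_; _≢_)
open import Relation.Nullary using (¬_)

record Edge {a : Level} (V : Set a) : Set a where
  constructor edge
  field
    u : V
    v : V
    u≢v : u ≢ v
open Edge public

SameEdge : ∀ {a} {V : Set a} → Edge V → Edge V → Set a
SameEdge e f = (u e ≡ u f × v e ≡ v f) ⊎ (u e ≡ v f × v e ≡ u f)

_∋ᵥ_ : ∀ {a} {V : Set a} → Edge V → V → Set a
e ∋ᵥ x = (u e ≡ x) ⊎ (v e ≡ x)

Adjacent : ∀ {a} {V : Set a} → Edge V → Edge V → Set a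
Adjacent {V = V} e f = ¬ SameEdge e f × Σ V (λ x → (e ∋ᵥ x) × (f ∋ᵥ x))

-- An ordered graph: a simple graph G together with an ordering
-- ℓ : E(G) → ℤ_m, represented as the list of the edges of G in which
-- the edge with label i sits at position i.  Since ℓ is a bijection,
-- the list has no repeated edge (as unordered pairs).
NoRepeat : ∀ {a} {V : Set a} → List (Edge V) → Set a
NoRepeat L = ∀ (i j : Fin (length L)) → SameEdge (lookup L i) (lookup L j) → i ≡ j

record OrderedGraph {a : Level} (V : Set a) : Set a where
  constructor ordered
  field
    edges    : List (Edge V)
    noRepeat : NoRepeat edges
open OrderedGraph public

∣E∣ : ∀ {a} {V : Set a} → OrderedGraph V → ℕ
∣E∣ G = length (edges G)

EdgeDisjoint : ∀ {a} {V : Set a} → OrderedGraph V → OrderedGraph V → Set a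
EdgeDisjoint G H =
  ∀ (i : Fin (∣E∣ G)) (j : Fin (∣E∣ H)) → ¬ SameEdge (lookup (edges G) i) (lookup (edges H) j)

-- ℓ₀ ∨ ℓ₁ : edges of G₁ get labels shifted by |E(G₀)|, i.e. list concatenation.
-- (Stated on edge lists; the no-repeat property of the result follows
-- from edge-disjointness.)
_∨ₑ_ : ∀ {a} {V : Set a} → List (Edge V) → List (Edge V) → List (Edge V)
L ∨ₑ M = L ++ M

-- For labels i < j (as integers in {0,…,m-1}), d_ℓ(e,e') = j - i.
-- MinSep L s : d_ℓ(e,e') ≥ s for every pair of adjacent edges with ℓ(e) < ℓ(e').
MinSep : ∀ {a} {V : Set a} → List (Edge V) → ℕ → Set a
MinSep L s = ∀ (i j : Fin (length L)) → toℕ i < toℕ j →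
  Adjacent (lookup L i) (lookup L j) → s ≤ toℕ j ∸ toℕ i

IsMs : ∀ {a} {V : Set a} → List (Edge V) → ℕ → Set a
IsMs L s = (1 ≤ s × s ≤ length L) × MinSep L s ×
  (∀ t → 1 ≤ t → t ≤ length L → MinSep L t → t ≤ s)

-- Take adjacent edges e, e' at positions i < j of X ∨ Y ∨ Z.  If both lie in X ∪ Y, or both
-- in Y ∪ Z, they sit at the same distance in X ∨ Y, resp. Y ∨ Z.  Otherwise e ∈ X and
-- e' ∈ Z, and removing the block Y between them shortens their distance by exactly |E(Y)|,
-- giving their distance in X ∨ Z.
module Submission where

open import Defs
open import Level using (Level)
open import Data.Nat using (ℕ; zero; suc; _≤_; _<_; _+_; _∸_; _⊓_; z≤n; s≤s)
open import Data.Nat.Properties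
open import Data.Fin using (Fin; toℕ) renaming (zero to fzero; suc to fsuc)
open import Algebra.Properties.CommutativeSemigroup +-commutativeSemigroup using (x∙yz≈y∙xz)
open import Data.List using (List; []; _∷_; length; lookup; _++_)
open import Data.List.Properties using (length-++-≤ˡ; ++-assoc)
open import Data.Product using (Σ; _×_; _,_)
open import Data.Empty using (⊥-elim)
open import Relation.Binary.PropositionalEquality

private
  variable
    a : Level
    A : Set a
    V : Set a

data _[_]=_ {A : Set a} : List A → ℕ → A → Set a where
  here  : ∀ {x xs} → (x ∷ xs) [ 0 ]= x
  there : ∀ {x xs n y} → xs [ n ]= y → (x ∷ xs) [ suc n ]= y

lookup⇒[]= : (L : List A) (i : Fin (length L)) → L [ toℕ i ]= lookup L i
lookup⇒[]= (x ∷ L) fzero    = here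
lookup⇒[]= (x ∷ L) (fsuc i) = there (lookup⇒[]= L i)

[]=⇒lookup : ∀ {L : List A} {n e} → L [ n ]= e →
             Σ (Fin (length L)) λ i → toℕ i ≡ n × lookup L i ≡ e
[]=⇒lookup here = fzero , refl , refl
[]=⇒lookup (there p) with []=⇒lookup p
... | i , refl , refl = fsuc i , refl , refl

[]=⇒< : ∀ {L : List A} {n e} → L [ n ]= e → n < length L
[]=⇒< here      = s≤s z≤n
[]=⇒< (there p) = s≤s ([]=⇒< p)

[]=-++⁺ˡ : ∀ {L M : List A} {n e} → L [ n ]= e → (L ++ M) [ n ]= e
[]=-++⁺ˡ here      = here
[]=-++⁺ˡ (there p) = there ([]=-++⁺ˡ p)

[]=-++⁺ʳ : ∀ (L : List A) {M n e} → M [ n ]= e → (L ++ M) [ length L + n ]= e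
[]=-++⁺ʳ []      p = p
[]=-++⁺ʳ (x ∷ L) p = there ([]=-++⁺ʳ L p)

data ++-Position {A : Set a} (L M : List A) : ℕ → A → Set a where
  inˡ : ∀ {n e} → L [ n ]= e → ++-Position L M n e
  inʳ : ∀ {n e} → M [ n ]= e → ++-Position L M (length L + n) e

++-position : ∀ (L : List A) {M n e} → (L ++ M) [ n ]= e → ++-Position L M n e
++-position []      p         = inʳ p
++-position (x ∷ L) here      = inˡ here
++-position (x ∷ L) (there p) with ++-position L p
... | inˡ q = inˡ (there q)
... | inʳ q = inʳ q

Separated : {V : Set a} → List (Edge V) → ℕ → Set a
Separated L s = ∀ {i j e f} → L [ i ]= e → L [ j ]= f → i < j → Adjacent e f → s ≤ j ∸ i

minSep⇒separated : ∀ {L : List (Edge V)} {s} → MinSep L s → Separated L s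
minSep⇒separated ms p q i<j adj with []=⇒lookup p | []=⇒lookup q
... | i , refl , refl | j , refl , refl = ms i j i<j adj

separated⇒minSep : ∀ {L : List (Edge V)} {s} → Separated L s → MinSep L s
separated⇒minSep {L = L} sep i j = sep (lookup⇒[]= L i) (lookup⇒[]= L j)

minSep-≤ : ∀ (L : List (Edge V)) {s t} → t ≤ s → MinSep L s → MinSep L t
minSep-≤ _ t≤s ms i j i<j adj = ≤-trans t≤s (ms i j i<j adj)

[m+[n+o]]∸p≡n+[[m+o]∸p] : ∀ m n o {p} → p ≤ m + o → (m + (n + o)) ∸ p ≡ n + ((m + o) ∸ p)
[m+[n+o]]∸p≡n+[[m+o]∸p] m n o {p} p≤m+o = begin
  (m + (n + o)) ∸ p ≡⟨ cong (_∸ p) (x∙yz≈y∙xz m n o) ⟩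
  (n + (m + o)) ∸ p ≡⟨ +-∸-assoc n p≤m+o ⟩
  n + ((m + o) ∸ p) ∎
  where open ≡-Reasoning

separated-++-++ : ∀ (X Y Z : List (Edge V)) {s} →
  Separated (X ++ Y) s → Separated (Y ++ Z) s → Separated (X ++ Z) (s ∸ length Y) →
  Separated (X ++ (Y ++ Z)) s
separated-++-++ X Y Z {s} sepXY sepYZ sepXZ p q i<j adj
  with ++-position X p | ++-position X q
... | inˡ pX | inˡ qX = sepXY ([]=-++⁺ˡ pX) ([]=-++⁺ˡ qX) i<j adj
... | inʳ pYZ | inˡ qX = ⊥-elim (≤⇒≯ (m≤m+n (length X) _) (<-trans i<j ([]=⇒< qX)))
... | inʳ {i} pYZ | inʳ {j} qYZ rewrite [m+n]∸[m+o]≡n∸o (length X) j i =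
  sepYZ pYZ qYZ (+-cancelˡ-< (length X) i j i<j) adj
... | inˡ {i} pX | inʳ qYZ with ++-position Y qYZ
...   | inˡ qY = sepXY ([]=-++⁺ˡ pX) ([]=-++⁺ʳ X qY) i<j adj
...   | inʳ {k} qZ = begin
  s                                       ≤⟨ m≤n+m∸n s (length Y) ⟩
  length Y + (s ∸ length Y)               ≤⟨ +-monoʳ-≤ (length Y) (sepXZ ([]=-++⁺ˡ pX) ([]=-++⁺ʳ X qZ) i<x+k adj) ⟩
  length Y + ((length X + k) ∸ i)         ≡⟨ sym ([m+[n+o]]∸p≡n+[[m+o]∸p] (length X) (length Y) k (<⇒≤ i<x+k)) ⟩
  (length X + (length Y + k)) ∸ i         ∎
  where
  open ≤-Reasoning
  i<x+k : i < length X + k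
  i<x+k = <-≤-trans ([]=⇒< pX) (m≤m+n (length X) k)

minSep-++-++ : ∀ (X Y Z : List (Edge V)) {s} →
  MinSep (X ++ Y) s → MinSep (Y ++ Z) s → MinSep (X ++ Z) (s ∸ length Y) →
  MinSep (X ++ (Y ++ Z)) s
minSep-++-++ X Y Z msXY msYZ msXZ = separated⇒minSep
  (separated-++-++ X Y Z (minSep⇒separated msXY) (minSep⇒separated msYZ) (minSep⇒separated msXZ))

≤-from-positive : ∀ m {n} → (1 ≤ m → m ≤ n) → m ≤ n
≤-from-positive zero    _ = z≤n
≤-from-positive (suc m) h = h (s≤s z≤n)

lemma2p3 : ∀ {a} {V : Set a} (X Y Z : OrderedGraph V) →
    EdgeDisjoint X Y → EdgeDisjoint Y Z → EdgeDisjoint X Z →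
    ∀ (sXYZ sXY sYZ sXZ : ℕ) →
    IsMs (edges X ∨ₑ (edges Y ∨ₑ edges Z)) sXYZ →
    IsMs (edges X ∨ₑ edges Y) sXY →
    IsMs (edges Y ∨ₑ edges Z) sYZ →
    IsMs (edges X ∨ₑ edges Z) sXZ →
    sXY ⊓ (sYZ ⊓ (∣E∣ Y + sXZ)) ≤ sXYZ
lemma2p3 {V = V} X Y Z _ _ _ sXYZ sXY sYZ sXZ
  (_ , _ , maximal) ((_ , sXY≤∣XY∣) , msXY , _) (_ , msYZ , _) (_ , msXZ , _) =
  ≤-from-positive s λ 1≤s → maximal s 1≤s s≤∣XYZ∣
    (minSep-++-++ xs ys zs
      (minSep-≤ (xs ++ ys) s≤sXY msXY)
      (minSep-≤ (ys ++ zs) s≤sYZ msYZ)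
      (minSep-≤ (xs ++ zs) (m≤n+o⇒m∸n≤o s (length ys) s≤∣Y∣+sXZ) msXZ))
  where
  xs ys zs : List (Edge V)
  xs = edges X
  ys = edges Y
  zs = edges Z
  s : ℕ
  s = sXY ⊓ (sYZ ⊓ (∣E∣ Y + sXZ))
  s≤sXY : s ≤ sXY
  s≤sXY = m⊓n≤m sXY _
  s≤sYZ : s ≤ sYZ
  s≤sYZ = ≤-trans (m⊓n≤n sXY _) (m⊓n≤m sYZ _)
  s≤∣Y∣+sXZ : s ≤ ∣E∣ Y + sXZ
  s≤∣Y∣+sXZ = ≤-trans (m⊓n≤n sXY _) (m⊓n≤n sYZ _)
  s≤∣XYZ∣ : s ≤ length (xs ++ (ys ++ zs))
  s≤∣XYZ∣ = ≤-trans s≤sXY (≤-trans sXY≤∣XY∣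
    (subst (length (xs ++ ys) ≤_) (cong length (++-assoc xs ys zs)) (length-++-≤ˡ (xs ++ ys))))
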